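{- For all integers $m,n\ge 1$, the minimum number of spotlights in a spotlight tiling of the $m\times n$ rectangle is $\min\{m,n\}$, and the maximum number of spotlights in a spotlight tiling of the $m\times n$ rectangle is $m+n-1$.
   Context: A region is a finite set of unit squares of the square grid whose edge-adjacency graph is connected. A northwest corner of a region $R$ is a square of $R$ such that neither the square directly above it nor the square directly to its left belongs to $R$. A spotlight tiling of $R$ is produced recursively: choose a northwest corner $s$ of $R$ and place a spotlight with endpoint $s$, extending either east (horizontally) or south (vertically) as far as possible, i.e. consisting of $s$ together with the maximal run of consecutive squares of $R$ in that direction. The uncovered squares form a disjoint union of regions (connected components), each of which is then given a spotlight tiling recursively; the empty region has exactly one (empty) tiling. The spotlight tiling is the final collection of spotlights, a partition of $R$ into segments. Two spotlight tilings are the same if and only if they give the same collection of spotlights. The number of spotlights in a tiling $t$ is the number of pieces of this collection. -}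

module Defs where

open import Level using (Level)
open import Data.Nat using (ℕ; zero; suc; _+_; _≤_; _<_)
open import Data.Product using (Σ; _×_; _,_; ∃)
open import Data.Sum using (_⊎_)
open import Data.List using (List; []; _∷_; concat; lookup; length)
open import Data.Fin using (Fin)
open import Data.List.Membership.Propositional using (_∈_)
open import Data.List.Relation.Binary.Pointwise using (Pointwise)
open import Relation.Nullary using (¬_)
open import Relation.Binary.PropositionalEquality using (_≡_; _≢_)

-- A unit square of the grid, written (row , column); rows increase
-- downward (south), columns increase to the right (east).
Sq : Set
Sq = ℕ × ℕ

row : Sq → ℕ
row (r , _) = r

col : Sq → ℕ
col (_ , c) = c

Region : Set₁
Region = Sq → Set

Above : Sq → Sq → Set
Above t s = (suc (row t) ≡ row s) × (col t ≡ col s)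

LeftOf : Sq → Sq → Set
LeftOf t s = (row t ≡ row s) × (suc (col t) ≡ col s)

Adj : Sq → Sq → Set
Adj x y = Above x y ⊎ Above y x ⊎ LeftOf x y ⊎ LeftOf y x

data PathIn (A : Region) : Sq → Sq → Set where
  here : ∀ {x} → A x → PathIn A x x
  there : ∀ {x y z} → A x → Adj x y → PathIn A y z → PathIn A x z

Connected : Region → Set
Connected A = ∀ x y → A x → A y → PathIn A x y

NWCorner : Region → Sq → Set
NWCorner R s = R s × (∀ t → Above t s → ¬ R t) × (∀ t → LeftOf t s → ¬ R t)

data Dir : Set where
  east south : Dir

step : Sq → Dir → ℕ → Sq
step (r , c) east i = (r , c + i)
step (r , c) south i = (r + i , c)

record Spotlight : Set where
  constructor spot
  field
    endpoint : Sq
    dir      : Dir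
    len      : ℕ

Cells : Spotlight → Region
Cells (spot s d k) x = Σ ℕ λ i → (i < k) × (x ≡ step s d i)

MaxRun : Region → Sq → Dir → ℕ → Set
MaxRun R s d k = (0 < k) × (∀ i → i < k → R (step s d i)) × ¬ R (step s d k)

_∖_ : Region → Region → Region
(A ∖ B) x = A x × ¬ B x

IsComponent : Region → Region → Set
IsComponent A C =
  (∀ x → C x → A x) × (∃ λ x → C x) × Connected C ×
  (∀ x y → C x → A y → Adj x y → C y)

IsComponentDecomposition : Region → List Region → Set
IsComponentDecomposition A Cs =
  (∀ i → IsComponent A (lookup Cs i)) ×
  (∀ i j → i ≢ j → ∀ x → lookup Cs i x → ¬ lookup Cs j x) ×
  (∀ x → A x → Σ (Fin (length Cs)) λ i → lookup Cs i x)

-- Spotlight tilings (as the list of spotlights produced).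
data Tiling : Region → List Spotlight → Set₁ where
  emptyT : ∀ {R} → (∀ x → ¬ R x) → Tiling R []
  stepT  : ∀ {R} (s : Sq) (d : Dir) (k : ℕ) (Cs : List Region)
             (Ts : List (List Spotlight)) →
           NWCorner R s → MaxRun R s d k →
           IsComponentDecomposition (R ∖ Cells (spot s d k)) Cs →
           Pointwise Tiling Cs Ts →
           Tiling R (spot s d k ∷ concat Ts)

Rect : ℕ → ℕ → Region
Rect m n (r , c) = (r < m) × (c < n)

numSpotlights : List Spotlight → ℕ
numSpotlights = length

module Submission where

-- Work with the translated box  Box a b m n  (rows a..a+m-1, columns b..b+n-1).
-- A box has a unique northwest corner, its origin; the maximal spotlights there
-- are its first row (east) or first column (south), and what remains uncovered is
-- again a box, (m-1)×n or m×(n-1).  A box is connected, so the remainder is a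
-- single component (or empty), and a tiling of the box is one spotlight followed
-- by a tiling of the smaller box.  Since tilings depend on their region only
-- extensionally, this says precisely that the spotlight counts of tilings of an
-- m×n box are the numbers generated by the recursion  SpotlightCount:
--   L(m,n) = 0 if m = 0 or n = 0,   L(m,n) = 1 + L(m-1,n) or 1 + L(m,n-1).

open import Defs
open import Data.Nat using (ℕ; _+_; _∸_; _≤_; _⊓_)
open import Data.Product using (Σ; _×_)
open import Data.List using (List)
open import Relation.Binary.PropositionalEquality using (_≡_)

open import Data.Nat using (zero; suc; _<_; z≤n; s≤s; z<s)
open import Data.Nat.Properties
  using (module ≤-Reasoning; <-cmp; <⇒≤; <-irrefl; ≤-trans; ≤-reflexive; ≤-total; n≤1+n;
         +-suc; +-identityʳ; +-cancelˡ-≡; m≢1+m+n;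
         ⊓-zeroʳ; ⊓-monoˡ-≤; ⊓-monoʳ-≤; m≤n⇒m⊓n≡m; m≥n⇒m⊓n≡n)
open import Data.Product using (_,_; proj₁)
open import Data.Product.Properties using (,-injectiveˡ; ,-injectiveʳ)
open import Data.Sum using (inj₁; inj₂)
open import Data.List using ([]; _∷_; concat; length)
open import Data.List.Properties using (++-identityʳ)
open import Data.List.Relation.Binary.Pointwise using (Pointwise; []; _∷_)
open import Data.Fin using (zero; suc)
open import Data.Empty using (⊥-elim)
open import Relation.Nullary using (¬_)
open import Relation.Binary.Definitions using (tri<; tri≈; tri>)
open import Relation.Unary using (_⊆_; _≐_; Empty; Satisfiable)
open import Relation.Unary.Properties using (≐-sym)
open import Relation.Binary.PropositionalEquality using (refl; sym; cong; cong₂; subst)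

private
  variable
    A B C R S : Region
    x y z s : Sq
    d : Dir
    a b i j k k′ m n L : ℕ
    t : List Spotlight

path-start : PathIn A x y → A x
path-start (here ax) = ax
path-start (there ax _ _) = ax

_++ₚ_ : PathIn A x y → PathIn A y z → PathIn A x z
here _ ++ₚ q = q
there ax adj p ++ₚ q = there ax adj (p ++ₚ q)

adj-sym : Adj x y → Adj y x
adj-sym (inj₁ above) = inj₂ (inj₁ above)
adj-sym (inj₂ (inj₁ below)) = inj₁ below
adj-sym (inj₂ (inj₂ (inj₁ left))) = inj₂ (inj₂ (inj₂ left))
adj-sym (inj₂ (inj₂ (inj₂ right))) = inj₂ (inj₂ (inj₁ right))

reverse-path : PathIn A x y → PathIn A y x
reverse-path (here ax) = here ax
reverse-path (there ax adj p) = reverse-path p ++ₚ there (path-start p) (adj-sym adj) (here ax)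

map-path : A ⊆ B → PathIn A x y → PathIn B x y
map-path A⊆B (here ax) = here (A⊆B ax)
map-path A⊆B (there ax adj p) = there (A⊆B ax) adj (map-path A⊆B p)

connected-≐ : A ≐ B → Connected A → Connected B
connected-≐ (A⊆B , B⊆A) conn x y bx by = map-path A⊆B (conn x y (B⊆A bx) (B⊆A by))

-- A component of a connected region is the whole region: walking along a path
-- from a point of the component, closure under adjacency keeps us inside it.
component-of-connected : Connected A → IsComponent A C → A ⊆ C
component-of-connected {A} {C} conn (C⊆A , (x₀ , cx₀) , _ , closed) {y} ay =
  walk (conn x₀ y (C⊆A x₀ cx₀) ay) cx₀
  where
  walk : PathIn A x z → C x → C z
  walk (here _) cx = cx
  walk (there {x} {x′} _ adj p) cx = walk p (closed x x′ cx (path-start p) adj)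

decompose-empty : Empty A → IsComponentDecomposition A []
decompose-empty empty = (λ ()) , (λ ()) , (λ x ax → ⊥-elim (empty x ax))

decompose-connected : Connected A → Satisfiable A → IsComponentDecomposition A (A ∷ [])
decompose-connected conn inhabited =
  (λ { zero → (λ x ax → ax) , inhabited , conn , (λ _ _ _ ay _ → ay) }) ,
  (λ { zero zero 0≢0 → ⊥-elim (0≢0 refl) }) ,
  (λ x ax → zero , ax)

nwcorner-≐ : R ≐ S → NWCorner R s → NWCorner S s
nwcorner-≐ (R⊆S , S⊆R) (rs , no-above , no-left) =
  R⊆S rs ,
  (λ t above st → no-above t above (S⊆R st)) ,
  (λ t left st → no-left t left (S⊆R st))

maxrun-≐ : R ≐ S → MaxRun R s d k → MaxRun S s d k
maxrun-≐ (R⊆S , S⊆R) (0<k , run , stop) =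
  0<k , (λ i i<k → R⊆S (run i i<k)) , (λ sk → stop (S⊆R sk))

minus-≐ : R ≐ S → (R ∖ C) ≐ (S ∖ C)
minus-≐ (R⊆S , S⊆R) = (λ (rx , ¬cx) → R⊆S rx , ¬cx) , (λ (sx , ¬cx) → S⊆R sx , ¬cx)

component-≐ : A ≐ B → IsComponent A C → IsComponent B C
component-≐ (A⊆B , B⊆A) (C⊆A , inhabited , conn , closed) =
  (λ x cx → A⊆B (C⊆A x cx)) , inhabited , conn ,
  (λ x y cx by adj → closed x y cx (B⊆A by) adj)

decomposition-≐ : ∀ {Cs} → A ≐ B →
                  IsComponentDecomposition A Cs → IsComponentDecomposition B Cs
decomposition-≐ A≐B@(_ , B⊆A) (components , disjoint , cover) =
  (λ i → component-≐ A≐B (components i)) , disjoint , (λ x bx → cover x (B⊆A bx))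

-- Tilings depend on their region only extensionally (only the first step
-- mentions the region itself; the components are reused unchanged).
tiling-≐ : R ≐ S → Tiling R t → Tiling S t
tiling-≐ (_ , S⊆R) (emptyT empty) = emptyT (λ x sx → empty x (S⊆R sx))
tiling-≐ R≐S (stepT s d k Cs Ts corner run decomposition tilings) =
  stepT s d k Cs Ts (nwcorner-≐ R≐S corner) (maxrun-≐ R≐S run)
    (decomposition-≐ {Cs = Cs} (minus-≐ R≐S) decomposition) tilings

empty-decomposition : IsComponentDecomposition A [] → Empty A
empty-decomposition (_ , _ , cover) x ax with cover x ax
... | () , _

-- When the uncovered part A of a step is connected, the recursive tilings of its
-- components amount to a single tiling of A: there is at most one component, and
-- it coincides with A.
remainder-tiling : ∀ {Cs Ts} → Connected A → IsComponentDecomposition A Cs →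
                   Pointwise Tiling Cs Ts → Tiling A (concat Ts)
remainder-tiling conn decomposition [] = emptyT (empty-decomposition decomposition)
remainder-tiling {A} conn (components , _ , _) (_∷_ {y = T} tiling []) =
  subst (Tiling A) (sym (++-identityʳ T)) (tiling-≐ C≐A tiling)
  where
  C≐A : _ ≐ A
  C≐A = (λ {x} → proj₁ (components zero) x) ,
        (λ {x} → component-of-connected conn (components zero))
remainder-tiling conn (components , disjoint , _) (_ ∷ _ ∷ _) with components (suc zero)
... | C′⊆A , (y , c′y) , _ =
  ⊥-elim (disjoint zero (suc zero) (λ ()) y
            (component-of-connected conn (components zero) (C′⊆A y c′y)) c′y)

place-spotlight : NWCorner R s → MaxRun R s d k → Connected (R ∖ Cells (spot s d k)) →
                  Tiling (R ∖ Cells (spot s d k)) t → Tiling R (spot s d k ∷ t)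
place-spotlight corner run conn (emptyT empty) =
  stepT _ _ _ [] [] corner run (decompose-empty empty) []
place-spotlight {R} {s} {d} {k} corner run conn T@(stepT s′ _ _ _ _ corner′ _ _ _) =
  subst (λ t → Tiling R (spot s d k ∷ t)) (++-identityʳ _)
    (stepT _ _ _ _ (_ ∷ []) corner run
       (decompose-connected conn (s′ , proj₁ corner′)) (T ∷ []))

Box : ℕ → ℕ → ℕ → ℕ → Region
Box a b m n x = Σ ℕ λ i → Σ ℕ λ j → (i < m) × (j < n) × (x ≡ (a + i , b + j))

rect≐box : Rect m n ≐ Box 0 0 m n
rect≐box = (λ { {r , c} (r<m , c<n) → r , c , r<m , c<n , refl })
         , (λ { (_ , _ , i<m , j<n , refl) → i<m , j<n })

box-no-rows : Empty (Box a b 0 n)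
box-no-rows _ (_ , _ , () , _)

box-no-cols : Empty (Box a b m 0)
box-no-cols _ (_ , _ , _ , () , _)

-- Membership of particular squares: a generic cell, the first row, the first
-- column, and the origin (the last three absorb the offsets a + 0 and b + 0).
box-cell : i < m → j < n → Box a b m n (a + i , b + j)
box-cell i<m j<n = _ , _ , i<m , j<n , refl

first-row : 0 < m → j < n → Box a b m n (a , b + j)
first-row {a = a} 0<m j<n = 0 , _ , 0<m , j<n , cong (_, _) (sym (+-identityʳ a))

first-col : i < m → 0 < n → Box a b m n (a + i , b)
first-col {b = b} i<m 0<n = _ , 0 , i<m , 0<n , cong (_ ,_) (sym (+-identityʳ b))

box-origin : 0 < m → 0 < n → Box a b m n (a , b)
box-origin {a = a} {b = b} 0<m 0<n =
  0 , 0 , 0<m , 0<n , cong₂ _,_ (sym (+-identityʳ a)) (sym (+-identityʳ b))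

-- A box is connected: every square is joined to (a + 0 , b + 0) by climbing its
-- column to the first row and then walking along the first row.
box-connected : Connected (Box a b m n)
box-connected {a} {b} {m} {n} x y bx by = to-origin bx ++ₚ reverse-path (to-origin by)
  where
  climb : ∀ i → i < m → j < n → PathIn (Box a b m n) (a + i , b + j) (a + 0 , b + j)
  climb zero i<m j<n = here (box-cell i<m j<n)
  climb (suc i) i<m j<n =
    there (box-cell i<m j<n) (inj₂ (inj₁ (sym (+-suc a i) , refl))) (climb i (<⇒≤ i<m) j<n)

  walk : ∀ j → 0 < m → j < n → PathIn (Box a b m n) (a + 0 , b + j) (a + 0 , b + 0)
  walk zero 0<m j<n = here (box-cell 0<m j<n)
  walk (suc j) 0<m j<n =
    there (box-cell 0<m j<n) (inj₂ (inj₂ (inj₂ (refl , sym (+-suc b j)))))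
      (walk j 0<m (<⇒≤ j<n))

  to-origin : Box a b m n z → PathIn (Box a b m n) z (a + 0 , b + 0)
  to-origin (i , j , i<m , j<n , refl) = climb i i<m j<n ++ₚ walk j (≤-trans z<s i<m) j<n

box-corner-unique : NWCorner (Box a b m n) s → s ≡ (a , b)
box-corner-unique {a} {b} (in-box , no-above , no-left) with in-box
... | suc i , j , i<m , j<n , refl =
  ⊥-elim (no-above _ (sym (+-suc a i) , refl) (box-cell (<⇒≤ i<m) j<n))
... | zero , suc j , i<m , j<n , refl =
  ⊥-elim (no-left _ (refl , sym (+-suc b j)) (box-cell i<m (<⇒≤ j<n)))
... | zero , zero , _ , _ , refl = cong₂ _,_ (+-identityʳ a) (+-identityʳ b)

box-corner : 0 < m → 0 < n → NWCorner (Box a b m n) (a , b)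
box-corner {a = a} {b = b} 0<m 0<n =
  box-origin 0<m 0<n ,
  (λ { _ (above , _) (_ , _ , _ , _ , refl) → m≢1+m+n a (sym above) }) ,
  (λ { _ (_ , left) (_ , _ , _ , _ , refl) → m≢1+m+n b (sym left) })

maxrun-unique : MaxRun R s d k → MaxRun R s d k′ → k ≡ k′
maxrun-unique {k = k} {k′ = k′} (_ , run , stop) (_ , run′ , stop′) with <-cmp k k′
... | tri< k<k′ _ _ = ⊥-elim (stop (run′ k k<k′))
... | tri≈ _ k≡k′ _ = k≡k′
... | tri> _ _ k′<k = ⊥-elim (stop′ (run k′ k′<k))

box-run-east : 0 < m → 0 < n → MaxRun (Box a b m n) (a , b) east n
box-run-east {n = n} {b = b} 0<m 0<n = 0<n , (λ j j<n → first-row 0<m j<n) , past-end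
  where
  past-end : ¬ Box _ b _ n (_ , b + n)
  past-end (_ , j , _ , j<n , e) = <-irrefl (sym (+-cancelˡ-≡ b n j (,-injectiveʳ e))) j<n

box-run-south : 0 < m → 0 < n → MaxRun (Box a b m n) (a , b) south m
box-run-south {m = m} {a = a} 0<m 0<n = 0<m , (λ i i<m → first-col i<m 0<n) , past-end
  where
  past-end : ¬ Box a _ m _ (a + m , _)
  past-end (i , _ , i<m , _ , e) = <-irrefl (sym (+-cancelˡ-≡ a m i (,-injectiveˡ e))) i<m

box-east-length : ∀ a b → MaxRun (Box a b (suc m) (suc n)) (a , b) east k → k ≡ suc n
box-east-length {m} {n} a b run =
  maxrun-unique {R = Box a b (suc m) (suc n)} {a , b} {east} run (box-run-east z<s z<s)

box-south-length : ∀ a b → MaxRun (Box a b (suc m) (suc n)) (a , b) south k → k ≡ suc m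
box-south-length {m} {n} a b run =
  maxrun-unique {R = Box a b (suc m) (suc n)} {a , b} {south} run (box-run-south z<s z<s)

box-minus-row : (Box a b (suc m) n ∖ Cells (spot (a , b) east n)) ≐ Box (suc a) b m n
box-minus-row {a} {b} = shrink , grow
  where
  shrink : (Box a b (suc m) n ∖ Cells (spot (a , b) east n)) ⊆ Box (suc a) b m n
  shrink ((zero , j , _ , j<n , refl) , not-first) =
    ⊥-elim (not-first (j , j<n , cong (_, b + j) (+-identityʳ a)))
  shrink ((suc i , j , s≤s i<m , j<n , refl) , _) = i , j , i<m , j<n , cong (_, b + j) (+-suc a i)

  grow : Box (suc a) b m n ⊆ (Box a b (suc m) n ∖ Cells (spot (a , b) east n))
  grow (i , j , i<m , j<n , refl) =
    (suc i , j , s≤s i<m , j<n , cong (_, b + j) (sym (+-suc a i))) ,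
    (λ (_ , _ , e) → m≢1+m+n a (sym (,-injectiveˡ e)))

box-minus-col : (Box a b m (suc n) ∖ Cells (spot (a , b) south m)) ≐ Box a (suc b) m n
box-minus-col {a} {b} = shrink , grow
  where
  shrink : (Box a b m (suc n) ∖ Cells (spot (a , b) south m)) ⊆ Box a (suc b) m n
  shrink ((i , zero , i<m , _ , refl) , not-first) =
    ⊥-elim (not-first (i , i<m , cong (a + i ,_) (+-identityʳ b)))
  shrink ((i , suc j , i<m , s≤s j<n , refl) , _) = i , j , i<m , j<n , cong (a + i ,_) (+-suc b j)

  grow : Box a (suc b) m n ⊆ (Box a b m (suc n) ∖ Cells (spot (a , b) south m))
  grow (i , j , i<m , j<n , refl) =
    (i , suc j , i<m , s≤s j<n , cong (a + i ,_) (sym (+-suc b j))) ,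
    (λ (_ , _ , e) → m≢1+m+n b (sym (,-injectiveʳ e)))

row-remainder-connected : Connected (Box a b (suc m) n ∖ Cells (spot (a , b) east n))
row-remainder-connected = connected-≐ (≐-sym box-minus-row) box-connected

col-remainder-connected : Connected (Box a b m (suc n) ∖ Cells (spot (a , b) south m))
col-remainder-connected = connected-≐ (≐-sym box-minus-col) box-connected

rest-after-row : ∀ {Cs Ts} →
                 IsComponentDecomposition (Box a b (suc m) n ∖ Cells (spot (a , b) east n)) Cs →
                 Pointwise Tiling Cs Ts → Tiling (Box (suc a) b m n) (concat Ts)
rest-after-row decomposition tilings =
  tiling-≐ box-minus-row (remainder-tiling row-remainder-connected decomposition tilings)

rest-after-col : ∀ {Cs Ts} →
                 IsComponentDecomposition (Box a b m (suc n) ∖ Cells (spot (a , b) south m)) Cs →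
                 Pointwise Tiling Cs Ts → Tiling (Box a (suc b) m n) (concat Ts)
rest-after-col decomposition tilings =
  tiling-≐ box-minus-col (remainder-tiling col-remainder-connected decomposition tilings)

add-row : Tiling (Box (suc a) b m (suc n)) t →
          Tiling (Box a b (suc m) (suc n)) (spot (a , b) east (suc n) ∷ t)
add-row T = place-spotlight (box-corner z<s z<s) (box-run-east z<s z<s)
              row-remainder-connected (tiling-≐ (≐-sym box-minus-row) T)

add-col : Tiling (Box a (suc b) (suc m) n) t →
          Tiling (Box a b (suc m) (suc n)) (spot (a , b) south (suc m) ∷ t)
add-col T = place-spotlight (box-corner z<s z<s) (box-run-south z<s z<s)
              col-remainder-connected (tiling-≐ (≐-sym box-minus-col) T)

data SpotlightCount : ℕ → ℕ → ℕ → Set where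
  no-rows : SpotlightCount 0 n 0
  no-cols : SpotlightCount m 0 0
  east    : SpotlightCount m (suc n) L → SpotlightCount (suc m) (suc n) (suc L)
  south   : SpotlightCount (suc m) n L → SpotlightCount (suc m) (suc n) (suc L)

tiling-of-empty : Empty R → Tiling R t → t ≡ []
tiling-of-empty _ (emptyT _) = refl
tiling-of-empty empty (stepT s _ _ _ _ (rs , _) _ _ _) = ⊥-elim (empty s rs)

count-of-tiling : ∀ m n → Tiling (Box a b m n) t → SpotlightCount m n (length t)
count-of-tiling zero n T rewrite tiling-of-empty box-no-rows T = no-rows
count-of-tiling (suc m) zero T rewrite tiling-of-empty box-no-cols T = no-cols
count-of-tiling (suc m) (suc n) (emptyT empty) = ⊥-elim (empty _ (box-origin z<s z<s))
count-of-tiling {a} {b} (suc m) (suc n) (stepT _ east _ _ _ corner run decomposition tilings)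
  with refl ← box-corner-unique corner
  with refl ← box-east-length a b run =
  east (count-of-tiling m (suc n) (rest-after-row decomposition tilings))
count-of-tiling {a} {b} (suc m) (suc n) (stepT _ south _ _ _ corner run decomposition tilings)
  with refl ← box-corner-unique corner
  with refl ← box-south-length a b run =
  south (count-of-tiling (suc m) n (rest-after-col decomposition tilings))

tiling-of-count : SpotlightCount m n L →
                  Σ (List Spotlight) λ t → Tiling (Box a b m n) t × length t ≡ L
tiling-of-count no-rows = [] , emptyT box-no-rows , refl
tiling-of-count no-cols = [] , emptyT box-no-cols , refl
tiling-of-count {a = a} {b} (east count) with _ , T , refl ← tiling-of-count {a = suc a} {b} count =
  _ , add-row T , refl
tiling-of-count {a = a} {b} (south count) with _ , T , refl ← tiling-of-count {a = a} {suc b} count =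
  _ , add-col T , refl

-- The bounds: each step of the recursion adds one spotlight while lowering
-- m ⊓ n by at most one and m + n by exactly one.

count-lower : SpotlightCount m n L → m ⊓ n ≤ L
count-lower no-rows = z≤n
count-lower (no-cols {m}) = ≤-reflexive (⊓-zeroʳ m)
count-lower (east {m} {n} count) = s≤s (≤-trans (⊓-monoʳ-≤ m (n≤1+n n)) (count-lower count))
count-lower (south {m} {n} count) = s≤s (≤-trans (⊓-monoˡ-≤ n (n≤1+n m)) (count-lower count))

count-upper : SpotlightCount m n L → L ≤ m + n ∸ 1
count-upper no-rows = z≤n
count-upper no-cols = z≤n
count-upper (east {m} {n} {L} count) = begin
  suc L               ≤⟨ s≤s (count-upper count) ⟩
  suc (m + suc n ∸ 1) ≡⟨ cong (λ k → suc (k ∸ 1)) (+-suc m n) ⟩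
  suc (m + n)         ≡⟨ sym (+-suc m n) ⟩
  m + suc n           ∎
  where open ≤-Reasoning
count-upper (south {m} {n} count) =
  ≤-trans (s≤s (count-upper count)) (≤-reflexive (sym (+-suc m n)))

-- Both bounds are attained: all rows (resp. all columns) gives the minimum;
-- all rows but the last, then the columns of the last row, gives the maximum.

all-rows : ∀ m n → SpotlightCount m (suc n) m
all-rows zero n = no-rows
all-rows (suc m) n = east (all-rows m n)

all-cols : ∀ m n → SpotlightCount (suc m) n n
all-cols m zero = no-cols
all-cols m (suc n) = south (all-cols m n)

count-min : ∀ m n → SpotlightCount (suc m) (suc n) (suc m ⊓ suc n)
count-min m n with ≤-total m n
... | inj₁ m≤n = subst (SpotlightCount (suc m) (suc n)) (sym (m≤n⇒m⊓n≡m (s≤s m≤n)))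
                   (all-rows (suc m) n)
... | inj₂ n≤m = subst (SpotlightCount (suc m) (suc n)) (sym (m≥n⇒m⊓n≡n (s≤s n≤m)))
                   (all-cols m (suc n))

count-max : ∀ m n → SpotlightCount (suc m) (suc n) (suc m + suc n ∸ 1)
count-max zero n = all-cols 0 (suc n)
count-max (suc m) n = east (count-max m n)

proposition3p4 : ∀ (m n : ℕ) → 1 ≤ m → 1 ≤ n →
    ((Σ (List Spotlight) λ t → Tiling (Rect m n) t × numSpotlights t ≡ m ⊓ n) ×
     (∀ t → Tiling (Rect m n) t → m ⊓ n ≤ numSpotlights t)) ×
    ((Σ (List Spotlight) λ t → Tiling (Rect m n) t × numSpotlights t ≡ m + n ∸ 1) ×
     (∀ t → Tiling (Rect m n) t → numSpotlights t ≤ m + n ∸ 1))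
proposition3p4 (suc m) (suc n) _ _ =
  (realised (count-min m n) , λ t T → count-lower (count-of-rect T)) ,
  (realised (count-max m n) , λ t T → count-upper (count-of-rect T))
  where
  count-of-rect : Tiling (Rect (suc m) (suc n)) t → SpotlightCount (suc m) (suc n) (length t)
  count-of-rect T = count-of-tiling (suc m) (suc n) (tiling-≐ rect≐box T)

  realised : SpotlightCount (suc m) (suc n) L →
             Σ (List Spotlight) λ t → Tiling (Rect (suc m) (suc n)) t × length t ≡ L
  realised count with t , T , t-length ← tiling-of-count count =
    t , tiling-≐ (≐-sym rect≐box) T , t-length
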